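{- Every homogeneous block of the table $D$ is a $q$-block for some value $q$; that is, all cells of the block contain the same value.
   Context: $\Sigma$ is an alphabet and $d:\Sigma\times\Sigma\to\mathbb{R}_{\ge 0}$ satisfies $d(a,a)=0$ and $d(a,b)>0$ for $a\ne b$. $P$ is a pattern of length $M$ and $T$ a text of length $N$, both indexed from $1$. A run of a string is a maximal substring consisting of one repeated letter. $\mathrm{DTW}_d(X,Y)$ is $0$ if both strings are empty and $\infty$ if exactly one is empty. Otherwise it is the minimum, over warping paths $\pi$ from $(1,1)$ to $(|X|,|Y|)$, of $\sum_{(i,j)\in\pi}d(X[i],Y[j])$, where each step of $\pi$ goes from $(i,j)$ to $(i+1,j)$, $(i+1,j+1)$ or $(i,j+1)$. $D$ is the $(M+1)\times(N+1)$ table with rows $0..M$ and columns $0..N$, defined by $D[0,j]=0$, $D[i,0]=+\infty$ for $i\ge1$, and, for $i,j\ge1$, $D[i,j]$ equal to the smallest $\mathrm{DTW}_d$ distance between $P[1..i]$ and a suffix of $T[1..j]$. A block is a subtable $D[i_p..j_p,\,i_t..j_t]$ where $P[i_p..j_p]$ is a run of $P$ or $i_p=j_p=0$, and $T[i_t..j_t]$ is a run of $T$ or $i_t=j_t=0$. A block with $i_p,i_t>0$ is homogeneous if $P[i_p]=T[i_t]$.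
   Formalization: The distance d takes non-negative rational values instead of values in $\mathbb{R}_{\ge 0}$, so the DTW distances and the entries of D are rationals or +∞. -}

module Defs where

open import Data.Nat using (ℕ; zero; suc; _+_; _∸_; _≤_)
open import Data.Rational using (ℚ; 0ℚ) renaming (_+_ to _+ℚ_; _≤_ to _≤ℚ_; _<_ to _<ℚ_)
open import Data.Product using (Σ; ∃; _×_; _,_)
open import Data.Sum using (_⊎_)
open import Data.Empty using (⊥)
open import Data.Unit using (⊤)
open import Relation.Binary.PropositionalEquality using (_≡_; _≢_)
open import Relation.Nullary using (¬_)

data Ext : Set where
  fin : ℚ → Ext
  ∞   : Ext

data _≤∞_ : Ext → Ext → Set where
  fin≤fin : ∀ {a b} → a ≤ℚ b → fin a ≤∞ fin b
  ≤∞-top  : ∀ {v} → v ≤∞ ∞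

-- A string of length n over A is given by its letters at positions 1..n
-- (1-indexed, as in the paper); values of the function outside 1..n are
-- never consulted.
Str : Set → Set
Str A = ℕ → A

record Distance (A : Set) : Set where
  field
    d      : A → A → ℚ
    d-refl : ∀ a → d a a ≡ 0ℚ
    d-pos  : ∀ a b → a ≢ b → 0ℚ <ℚ d a b

data Path : ℕ → ℕ → Set where
  start : Path 1 1
  down  : ∀ {i j} → Path i j → Path (suc i) j
  diag  : ∀ {i j} → Path i j → Path (suc i) (suc j)
  right : ∀ {i j} → Path i j → Path i (suc j)

module _ {A : Set} (δ : Distance A) where
  open Distance δ

  cost : (X Y : Str A) → ∀ {i j} → Path i j → ℚ
  cost X Y start = d (X 1) (Y 1)
  cost X Y (down {i} {j} p)  = cost X Y p +ℚ d (X (suc i)) (Y j)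
  cost X Y (diag {i} {j} p)  = cost X Y p +ℚ d (X (suc i)) (Y (suc j))
  cost X Y (right {i} {j} p) = cost X Y p +ℚ d (X i) (Y (suc j))

  IsDTW : Str A → ℕ → Str A → ℕ → Ext → Set
  IsDTW X zero    Y zero    v = v ≡ fin 0ℚ
  IsDTW X zero    Y (suc n) v = v ≡ ∞
  IsDTW X (suc m) Y zero    v = v ≡ ∞
  IsDTW X (suc m) Y (suc n) v =
    Σ ℚ λ c → (v ≡ fin c)
      × (Σ (Path (suc m) (suc n)) λ p → cost X Y p ≡ c)
      × (∀ (p : Path (suc m) (suc n)) → c ≤ℚ cost X Y p)

  -- The suffix T[s+1..j] of T[1..j] (s ≤ j), as a string of length j ∸ s.
  shift : Str A → ℕ → Str A
  shift T s l = T (s + l)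

  IsD : Str A → Str A → ℕ → ℕ → Ext → Set
  IsD P T zero    j       v = v ≡ fin 0ℚ
  IsD P T (suc i) zero    v = v ≡ ∞
  IsD P T (suc i) (suc j) v =
      (Σ ℕ λ s → s ≤ suc j × IsDTW P (suc i) (shift T s) (suc j ∸ s) v)
    × (∀ s w → s ≤ suc j → IsDTW P (suc i) (shift T s) (suc j ∸ s) w → v ≤∞ w)

record IsRun {A : Set} (X : Str A) (n a b : ℕ) : Set where
  field
    1≤a   : 1 ≤ a
    a≤b   : a ≤ b
    b≤n   : b ≤ n
    const : ∀ t → a ≤ t → t ≤ b → X t ≡ X a
    left  : a ≡ 1 ⊎ X (a ∸ 1) ≢ X a
    rightm : b ≡ n ⊎ X (suc b) ≢ X a

{-# OPTIONS --safe #-}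
module Submission where

-- D is computed by the recurrence D[i,j] = min (D[i-1,j-1], D[i-1,j], D[i,j-1]) + d(P[i],T[j])
-- (a cheapest warping path against a best suffix ends with one of the three steps). Inside a
-- homogeneous block the added cost is 0, so each cell is the minimum of its three neighbours and
-- none exceeds the top-left corner q. Conversely, along a run of T the costs d(P[i],T[j]) do not
-- depend on j, so no row of D drops below its value at the first column of the run (symmetrically
-- for runs of P); hence the row above and the column left of the block are ≥ q, and the minimum
-- recurrence carries this bound into the block.

open import Defs
open import Algebra.Properties.CommutativeSemigroup using (xy∙z≈xz∙y)
import Algebra.Construct.NaturalChoice.Min as Min
open import Data.Empty using (⊥-elim)
open import Data.Nat using (ℕ; zero; suc; _+_; _∸_; _≤_; s≤s)
import Data.Nat.Properties as ℕ
open import Data.Product using (Σ; _,_)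
open import Data.Rational using (ℚ; 0ℚ) renaming (_+_ to _+ℚ_; _≤_ to _≤ℚ_; _<_ to _<ℚ_)
import Data.Rational.Properties as ℚ
open import Data.Sum as Sum using (_⊎_; inj₁; inj₂)
open import Function using (flip)
open import Level using (0ℓ)
open import Relation.Binary
  using (TotalOrder; IsTotalOrder; Reflexive; Transitive; Antisymmetric; Total; Maximum; _Preserves_⟶_)
open import Relation.Binary.PropositionalEquality
open import Relation.Nullary using (¬_)

≤∞-refl : Reflexive _≤∞_
≤∞-refl {fin a} = fin≤fin ℚ.≤-refl
≤∞-refl {∞}     = ≤∞-top

≤∞-reflexive : ∀ {x y} → x ≡ y → x ≤∞ y
≤∞-reflexive refl = ≤∞-refl

≤∞-trans : Transitive _≤∞_
≤∞-trans (fin≤fin p) (fin≤fin q) = fin≤fin (ℚ.≤-trans p q)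
≤∞-trans _           ≤∞-top      = ≤∞-top

≤∞-antisym : Antisymmetric _≡_ _≤∞_
≤∞-antisym (fin≤fin p) (fin≤fin q) = cong fin (ℚ.≤-antisym p q)
≤∞-antisym ≤∞-top      ≤∞-top      = refl

≤∞-total : Total _≤∞_
≤∞-total (fin a) (fin b) = Sum.map fin≤fin fin≤fin (ℚ.≤-total a b)
≤∞-total x       ∞       = inj₁ ≤∞-top
≤∞-total ∞       (fin b) = inj₂ ≤∞-top

fin≤fin⁻¹ : ∀ {a b} → fin a ≤∞ fin b → a ≤ℚ b
fin≤fin⁻¹ (fin≤fin a≤b) = a≤b

∞-maximum : Maximum _≤∞_ ∞
∞-maximum _ = ≤∞-top

≤∞-isTotalOrder : IsTotalOrder _≡_ _≤∞_
≤∞-isTotalOrder = record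
  { isPartialOrder = record
    { isPreorder = record
      { isEquivalence = isEquivalence
      ; reflexive     = ≤∞-reflexive
      ; trans         = ≤∞-trans
      }
    ; antisym = ≤∞-antisym
    }
  ; total = ≤∞-total
  }

≤∞-totalOrder : TotalOrder 0ℓ 0ℓ 0ℓ
≤∞-totalOrder = record { isTotalOrder = ≤∞-isTotalOrder }

open Min ≤∞-totalOrder
  using (x⊓y≤x; x⊓y≤y; x≤y⇒x⊓z≤y; x≤y⇒x⊓y≈x; ⊓-glb; ⊓-mono-≤; ⊓-sel; ⊓-idem;
         ⊓-identityˡ; ⊓-identityʳ; mono-≤-distrib-⊓; ⊓-commutativeSemigroup)
  renaming (_⊓_ to infixl 30 _⊓_)

-- _≤∞_ has the default precedence 20, so _⊓_ and _⊕_ must bind tighter than it.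
infixl 25 _⊕_

_⊕_ : Ext → ℚ → Ext
fin a ⊕ γ = fin (a +ℚ γ)
∞     ⊕ γ = ∞

⊕-monoˡ-≤ : ∀ γ → (_⊕ γ) Preserves _≤∞_ ⟶ _≤∞_
⊕-monoˡ-≤ γ (fin≤fin a≤b) = fin≤fin (ℚ.+-monoˡ-≤ γ a≤b)
⊕-monoˡ-≤ γ ≤∞-top        = ≤∞-top

⊕-identityʳ : ∀ x → x ⊕ 0ℚ ≡ x
⊕-identityʳ (fin a) = cong fin (ℚ.+-identityʳ a)
⊕-identityʳ ∞       = refl

x≤x⊕γ : ∀ x {γ} → 0ℚ ≤ℚ γ → x ≤∞ x ⊕ γ
x≤x⊕γ (fin a) {γ} 0≤γ = fin≤fin (subst (_≤ℚ a +ℚ γ) (ℚ.+-identityʳ a) (ℚ.+-monoʳ-≤ a 0≤γ))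
x≤x⊕γ ∞       _   = ≤∞-top

⊕-distribʳ-⊓ : ∀ γ x y → (x ⊓ y) ⊕ γ ≡ (x ⊕ γ) ⊓ (y ⊕ γ)
⊕-distribʳ-⊓ γ = mono-≤-distrib-⊓ (cong (_⊕ γ)) (⊕-monoˡ-≤ γ)

neighbourMin : (ℕ → ℕ → Ext) → ℕ → ℕ → Ext
neighbourMin F i j = F i j ⊓ F i (suc j) ⊓ F (suc i) j

neighbourMin-≤-diag : ∀ F i j → neighbourMin F i j ≤∞ F i j
neighbourMin-≤-diag F i j = x≤y⇒x⊓z≤y (F (suc i) j) (x⊓y≤x (F i j) (F i (suc j)))

neighbourMin-≤-up : ∀ F i j → neighbourMin F i j ≤∞ F i (suc j)
neighbourMin-≤-up F i j = x≤y⇒x⊓z≤y (F (suc i) j) (x⊓y≤y (F i j) (F i (suc j)))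

neighbourMin-≤-left : ∀ F i j → neighbourMin F i j ≤∞ F (suc i) j
neighbourMin-≤-left F i j = x⊓y≤y (F i j ⊓ F i (suc j)) (F (suc i) j)

neighbourMin-glb : ∀ {w} F i j → w ≤∞ F i j → w ≤∞ F i (suc j) → w ≤∞ F (suc i) j
                 → w ≤∞ neighbourMin F i j
neighbourMin-glb F i j w≤diag w≤up w≤left = ⊓-glb (⊓-glb w≤diag w≤up) w≤left

neighbourMin-mono : ∀ F G i j → F i j ≤∞ G i j → F i (suc j) ≤∞ G i (suc j) → F (suc i) j ≤∞ G (suc i) j
                  → neighbourMin F i j ≤∞ neighbourMin G i j
neighbourMin-mono F G i j ≤diag ≤up ≤left = ⊓-mono-≤ (⊓-mono-≤ ≤diag ≤up) ≤left

neighbourMin-sel : ∀ F i j → neighbourMin F i j ≡ F i j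
                           ⊎ neighbourMin F i j ≡ F i (suc j)
                           ⊎ neighbourMin F i j ≡ F (suc i) j
neighbourMin-sel F i j with ⊓-sel (F i j ⊓ F i (suc j)) (F (suc i) j) | ⊓-sel (F i j) (F i (suc j))
... | inj₂ ≡left | _          = inj₂ (inj₂ ≡left)
... | inj₁ ≡m    | inj₁ ≡diag = inj₁ (trans ≡m ≡diag)
... | inj₁ ≡m    | inj₂ ≡up   = inj₂ (inj₁ (trans ≡m ≡up))

⊕-distribʳ-neighbourMin : ∀ F i j γ → neighbourMin F i j ⊕ γ ≡ neighbourMin (λ i′ j′ → F i′ j′ ⊕ γ) i j
⊕-distribʳ-neighbourMin F i j γ =
  trans (⊕-distribʳ-⊓ γ (F i j ⊓ F i (suc j)) (F (suc i) j))
        (cong (_⊓ (F (suc i) j ⊕ γ)) (⊕-distribʳ-⊓ γ (F i j) (F i (suc j))))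

record ObeysRecurrence (F : ℕ → ℕ → Ext) (c : ℕ → ℕ → ℚ) : Set where
  field
    recurrence : ∀ i j → F (suc i) (suc j) ≡ neighbourMin F i j ⊕ c (suc i) (suc j)

open ObeysRecurrence

transpose : ∀ {F c} → ObeysRecurrence F c → ObeysRecurrence (flip F) (flip c)
transpose {F} {c} F-rec .recurrence i j =
  trans (recurrence F-rec j i)
        (cong (_⊕ c (suc j) (suc i))
              (xy∙z≈xz∙y ⊓-commutativeSemigroup (F j i) (F j (suc i)) (F (suc j) i)))

recurrence-monotone : ∀ {F G c} → ObeysRecurrence F c → ObeysRecurrence G c
                    → (∀ i → F i 0 ≤∞ G i 0) → (∀ j → F 0 j ≤∞ G 0 j)
                    → ∀ i j → F i j ≤∞ G i j
recurrence-monotone {F} {G} {c} F-rec G-rec col₀ row₀ = go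
  where
  go : ∀ i j → F i j ≤∞ G i j
  go zero    j       = row₀ j
  go (suc i) zero    = col₀ (suc i)
  go (suc i) (suc j) =
    subst₂ _≤∞_ (sym (recurrence F-rec i j)) (sym (recurrence G-rec i j))
      (⊕-monoˡ-≤ (c (suc i) (suc j)) (neighbourMin-mono F G i j (go i j) (go i (suc j)) (go (suc i) j)))

module Recurrence {F : ℕ → ℕ → Ext} {c : ℕ → ℕ → ℚ}
                  (F-rec : ObeysRecurrence F c) (c≥0 : ∀ i j → 0ℚ ≤ℚ c i j) where

  open ObeysRecurrence F-rec renaming (recurrence to step)

  step-≤ : ∀ i j {x} → neighbourMin F i j ≤∞ x → F (suc i) (suc j) ≤∞ x ⊕ c (suc i) (suc j)
  step-≤ i j m≤x = ≤∞-trans (≤∞-reflexive (step i j)) (⊕-monoˡ-≤ _ m≤x)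

  step-≤-diag : ∀ i j → F (suc i) (suc j) ≤∞ F i j ⊕ c (suc i) (suc j)
  step-≤-diag i j = step-≤ i j (neighbourMin-≤-diag F i j)

  step-≤-up : ∀ i j → F (suc i) (suc j) ≤∞ F i (suc j) ⊕ c (suc i) (suc j)
  step-≤-up i j = step-≤ i j (neighbourMin-≤-up F i j)

  step-≤-left : ∀ i j → F (suc i) (suc j) ≤∞ F (suc i) j ⊕ c (suc i) (suc j)
  step-≤-left i j = step-≤ i j (neighbourMin-≤-left F i j)

  step-glb : ∀ {w} i j {γ} → c (suc i) (suc j) ≡ γ
           → w ≤∞ F i j ⊕ γ → w ≤∞ F i (suc j) ⊕ γ → w ≤∞ F (suc i) j ⊕ γ
           → w ≤∞ F (suc i) (suc j)
  step-glb {w} i j {γ} refl w≤diag w≤up w≤left =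
    subst (w ≤∞_) (sym (trans (step i j) (⊕-distribʳ-neighbourMin F i j γ)))
      (neighbourMin-glb (λ i′ j′ → F i′ j′ ⊕ γ) i j w≤diag w≤up w≤left)

  step-free : ∀ i j → c (suc i) (suc j) ≡ 0ℚ → F (suc i) (suc j) ≡ neighbourMin F i j
  step-free i j c≡0 = trans (step i j) (trans (cong (_ ⊕_) c≡0) (⊕-identityʳ _))

  row-≥-run-start : ∀ {a b}
              → (∀ r j → suc a ≤ j → j ≤ b → c r j ≡ c r (suc a))
              → (∀ j → suc a ≤ j → j ≤ b → F 0 (suc a) ≤∞ F 0 j)
              → ∀ r j → suc a ≤ j → j ≤ b → F r (suc a) ≤∞ F r j
  row-≥-run-start {a} {b} cols-alike row₀ = go
    where
    go : ∀ r j → suc a ≤ j → j ≤ b → F r (suc a) ≤∞ F r j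
    go zero    j       a<j j≤b = row₀ j a<j j≤b
    go (suc r) (suc j) a<j j≤b with ℕ.m≤n⇒m<n∨m≡n a<j
    ... | inj₂ refl        = ≤∞-refl
    ... | inj₁ (s≤s a<j-1) =
      step-glb r j (cols-alike (suc r) (suc j) a<j j≤b)
        (≤∞-trans (step-≤-up r a) (⊕-monoˡ-≤ _ (go r j a<j-1 (ℕ.<⇒≤ j≤b))))
        (≤∞-trans (step-≤-up r a) (⊕-monoˡ-≤ _ (go r (suc j) a<j j≤b)))
        (≤∞-trans (go (suc r) j a<j-1 (ℕ.<⇒≤ j≤b)) (x≤x⊕γ _ (c≥0 (suc r) (suc a))))

module HomogeneousBlock {F : ℕ → ℕ → Ext} {c : ℕ → ℕ → ℚ}
  (F-rec : ObeysRecurrence F c) (c≥0 : ∀ i j → 0ℚ ≤ℚ c i j)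
  (ip′ jp it′ jt : ℕ)
  (cols-alike : ∀ r j → suc it′ ≤ j → j ≤ jt → c r j ≡ c r (suc it′))
  (rows-alike : ∀ i s → suc ip′ ≤ i → i ≤ jp → c i s ≡ c (suc ip′) s)
  (corner-free : c (suc ip′) (suc it′) ≡ 0ℚ)
  (row₀ : ∀ j → suc it′ ≤ j → j ≤ jt → F 0 (suc it′) ≤∞ F 0 j)
  (col₀ : ∀ i → suc ip′ ≤ i → i ≤ jp → F (suc ip′) 0 ≤∞ F i 0)
  where

  open Recurrence F-rec c≥0
  private
    module Transposed = Recurrence (transpose F-rec) (λ i j → c≥0 j i)

  ip it : ℕ
  ip = suc ip′
  it = suc it′

  q : Ext
  q = F ip it

  free-step : ∀ i j → ip ≤ suc i → suc i ≤ jp → it ≤ suc j → suc j ≤ jt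
            → F (suc i) (suc j) ≡ neighbourMin F i j
  free-step i j ip≤ ≤jp it≤ ≤jt =
    step-free i j (trans (cols-alike _ _ it≤ ≤jt) (trans (rows-alike _ _ ip≤ ≤jp) corner-free))

  corner : q ≡ neighbourMin F ip′ it′
  corner = step-free ip′ it′ corner-free

  ≤-corner : ∀ i j → ip ≤ i → i ≤ jp → it ≤ j → j ≤ jt → F i j ≤∞ q
  ≤-corner (suc i) (suc j) ip≤ ≤jp it≤ ≤jt with ℕ.m≤n⇒m<n∨m≡n ip≤ | ℕ.m≤n⇒m<n∨m≡n it≤
  ... | inj₂ refl | inj₂ refl = ≤∞-refl
  ... | inj₁ ip<  | _         =
    ≤∞-trans (≤∞-reflexive (free-step i j ip≤ ≤jp it≤ ≤jt))
      (≤∞-trans (neighbourMin-≤-up F i j) (≤-corner i (suc j) (ℕ.≤-pred ip<) (ℕ.<⇒≤ ≤jp) it≤ ≤jt))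
  ... | inj₂ refl | inj₁ it<  =
    ≤∞-trans (≤∞-reflexive (free-step i j ip≤ ≤jp it≤ ≤jt))
      (≤∞-trans (neighbourMin-≤-left F i j) (≤-corner (suc i) j ip≤ ≤jp (ℕ.≤-pred it<) (ℕ.<⇒≤ ≤jt)))

  top-edge : ∀ j → it′ ≤ j → j ≤ jt → q ≤∞ F ip′ j
  top-edge j it′≤j j≤jt with ℕ.m≤n⇒m<n∨m≡n it′≤j
  ... | inj₂ refl = ≤∞-trans (≤∞-reflexive corner) (neighbourMin-≤-diag F ip′ it′)
  ... | inj₁ it≤j = ≤∞-trans (≤∞-reflexive corner)
    (≤∞-trans (neighbourMin-≤-up F ip′ it′) (row-≥-run-start cols-alike row₀ ip′ j it≤j j≤jt))

  left-edge : ∀ i → ip′ ≤ i → i ≤ jp → q ≤∞ F i it′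
  left-edge i ip′≤i i≤jp with ℕ.m≤n⇒m<n∨m≡n ip′≤i
  ... | inj₂ refl = ≤∞-trans (≤∞-reflexive corner) (neighbourMin-≤-diag F ip′ it′)
  ... | inj₁ ip≤i = ≤∞-trans (≤∞-reflexive corner)
    (≤∞-trans (neighbourMin-≤-left F ip′ it′)
              (Transposed.row-≥-run-start (λ r i → rows-alike i r) col₀ it′ i ip≤i i≤jp))

  ≥-corner : ∀ i j → ip′ ≤ i → i ≤ jp → it′ ≤ j → j ≤ jt → q ≤∞ F i j
  ≥-corner i j ip′≤i i≤jp it′≤j j≤jt with ℕ.m≤n⇒m<n∨m≡n ip′≤i | ℕ.m≤n⇒m<n∨m≡n it′≤j
  ... | inj₂ refl | _         = top-edge j it′≤j j≤jt
  ... | inj₁ _    | inj₂ refl = left-edge i ip′≤i i≤jp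
  ≥-corner (suc i) (suc j) _ ≤jp _ ≤jt | inj₁ (s≤s ip′≤i) | inj₁ (s≤s it′≤j) =
    subst (q ≤∞_) (sym (free-step i j (s≤s ip′≤i) ≤jp (s≤s it′≤j) ≤jt)) (neighbourMin-glb F i j
      (≥-corner i j ip′≤i (ℕ.<⇒≤ ≤jp) it′≤j (ℕ.<⇒≤ ≤jt))
      (≥-corner i (suc j) ip′≤i (ℕ.<⇒≤ ≤jp) (ℕ.m≤n⇒m≤1+n it′≤j) ≤jt)
      (≥-corner (suc i) j (ℕ.m≤n⇒m≤1+n ip′≤i) ≤jp it′≤j (ℕ.<⇒≤ ≤jt)))

  constant : ∀ i j → ip ≤ i → i ≤ jp → it ≤ j → j ≤ jt → F i j ≡ q
  constant i j ip≤i i≤jp it≤j j≤jt =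
    ≤∞-antisym (≤-corner i j ip≤i i≤jp it≤j j≤jt) (≥-corner i j (ℕ.<⇒≤ ip≤i) i≤jp (ℕ.<⇒≤ it≤j) j≤jt)

no-path-to-row₀ : ∀ {j} → ¬ Path 0 j
no-path-to-row₀ (right p) = no-path-to-row₀ p

no-path-to-column₀ : ∀ {i} → ¬ Path i 0
no-path-to-column₀ (down p) = no-path-to-column₀ p

module Table {A : Set} (δ : Distance A) (P : Str A) where
  open Distance δ

  d-nonneg : ∀ a b → 0ℚ ≤ℚ d a b
  d-nonneg a b = ℚ.≮⇒≥ λ d<0 → ℚ.<-asym (d-pos a b (a≢b d<0)) d<0
    where
    a≢b : d a b <ℚ 0ℚ → a ≢ b
    a≢b d<0 refl = ℚ.<-irrefl refl (subst (_<ℚ 0ℚ) (d-refl a) d<0)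

  cell : Str A → ℕ → ℕ → ℚ
  cell T i j = d (P i) (T j)

  D : Str A → ℕ → ℕ → Ext
  D T zero    j       = fin 0ℚ
  D T (suc i) zero    = ∞
  D T (suc i) (suc j) = (D T i j ⊓ D T i (suc j) ⊓ D T (suc i) j) ⊕ cell T (suc i) (suc j)

  D-recurrence : ∀ T → ObeysRecurrence (D T) (cell T)
  D-recurrence T .recurrence i j = refl

  cell-nonneg : ∀ T i j → 0ℚ ≤ℚ cell T i j
  cell-nonneg T i j = d-nonneg (P i) (T j)

  module DRecurrence (T : Str A) = Recurrence (D-recurrence T) (cell-nonneg T)

  D-nonneg : ∀ T i j → fin 0ℚ ≤∞ D T i j
  D-nonneg T zero    j       = ≤∞-refl
  D-nonneg T (suc i) zero    = ≤∞-top
  D-nonneg T (suc i) (suc j) =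
    DRecurrence.step-glb T i j refl (nonneg⊕ i j) (nonneg⊕ i (suc j)) (nonneg⊕ (suc i) j)
    where
    nonneg⊕ : ∀ i′ j′ → fin 0ℚ ≤∞ D T i′ j′ ⊕ cell T (suc i) (suc j)
    nonneg⊕ i′ j′ = ≤∞-trans (D-nonneg T i′ j′) (x≤x⊕γ _ (cell-nonneg T (suc i) (suc j)))

  D-≤-cost : ∀ T {i j} (p : Path (suc i) (suc j)) → D T (suc i) (suc j) ≤∞ fin (cost δ P T p)
  D-≤-cost T start =
    ≤∞-trans (DRecurrence.step-≤-diag T 0 0) (≤∞-reflexive (cong fin (ℚ.+-identityˡ _)))
  D-≤-cost T (down {zero} p)           = ⊥-elim (no-path-to-row₀ p)
  D-≤-cost T (down {suc i} {suc j} p)  =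
    ≤∞-trans (DRecurrence.step-≤-up T (suc i) j) (⊕-monoˡ-≤ _ (D-≤-cost T p))
  D-≤-cost T (diag {zero} p)           = ⊥-elim (no-path-to-row₀ p)
  D-≤-cost T (diag {suc i} {zero} p)   = ⊥-elim (no-path-to-column₀ p)
  D-≤-cost T (diag {suc i} {suc j} p)  =
    ≤∞-trans (DRecurrence.step-≤-diag T (suc i) (suc j)) (⊕-monoˡ-≤ _ (D-≤-cost T p))
  D-≤-cost T (right {suc i} {zero} p)  = ⊥-elim (no-path-to-column₀ p)
  D-≤-cost T (right {suc i} {suc j} p) =
    ≤∞-trans (DRecurrence.step-≤-left T i (suc j)) (⊕-monoˡ-≤ _ (D-≤-cost T p))

  D-unfold : ∀ T i {n m} → n ≡ suc m
           → D T (suc i) n ≡ (D T i m ⊓ D T i n ⊓ D T (suc i) m) ⊕ cell T (suc i) n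
  D-unfold T i refl = refl

  D-≤-D-shift : ∀ T s i j → D T i (s + j) ≤∞ D (shift δ T s) i j
  D-≤-D-shift T s = recurrence-monotone shifted (D-recurrence (shift δ T s)) col₀ (λ _ → ≤∞-refl)
    where
    shifted : ObeysRecurrence (λ i j → D T i (s + j)) (cell (shift δ T s))
    shifted .recurrence i j = D-unfold T i (ℕ.+-suc s j)
    col₀ : ∀ i → D T i (s + 0) ≤∞ D (shift δ T s) i 0
    col₀ zero    = ≤∞-refl
    col₀ (suc i) = ≤∞-top

  D-≤-shift-cost : ∀ T s {i l j} → s + suc l ≡ j → (p : Path (suc i) (suc l))
                  → D T (suc i) j ≤∞ fin (cost δ P (shift δ T s) p)
  D-≤-shift-cost T s {i} {l} refl p =
    ≤∞-trans (D-≤-D-shift T s (suc i) (suc l)) (D-≤-cost (shift δ T s) p)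

  module _ (T : Str A) where

    record OptimalAlignment (i k : ℕ) : Set where
      field
        offset len : ℕ
        fits       : offset + suc len ≡ suc k
        path       : Path (suc i) (suc len)
        D≡cost     : D T (suc i) (suc k) ≡ fin (cost δ P (shift δ T offset) path)

    private
      extend-cost : ∀ {m x c r col col′} → m ≡ x → x ≡ fin c → col′ ≡ col
                  → m ⊕ d (P r) (T col) ≡ fin (c +ℚ d (P r) (T col′))
      extend-cost refl refl refl = refl

    first-row : ∀ k → OptimalAlignment 0 k
    first-row k = record
      { offset = k ; len = 0 ; fits = ℕ.+-comm k 1 ; path = start ; D≡cost = D≡d }
      where
      D≡d : D T 1 (suc k) ≡ fin (d (P 1) (T (k + 1)))
      D≡d = begin
        neighbourMin (D T) 0 k ⊕ cell T 1 (suc k) ≡⟨ cong (_⊕ cell T 1 (suc k)) min≡0 ⟩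
        fin (0ℚ +ℚ d (P 1) (T (suc k)))          ≡⟨ cong fin (ℚ.+-identityˡ _) ⟩
        fin (d (P 1) (T (suc k)))                ≡⟨ cong (λ n → fin (d (P 1) (T n))) (ℕ.+-comm 1 k) ⟩
        fin (d (P 1) (T (k + 1)))                ∎
        where
        open ≡-Reasoning
        min≡0 : neighbourMin (D T) 0 k ≡ fin 0ℚ
        min≡0 = trans (cong (_⊓ D T 1 k) (⊓-idem (fin 0ℚ))) (x≤y⇒x⊓y≈x (D-nonneg T 1 k))

    via-diag : ∀ {i k} → neighbourMin (D T) (suc i) (suc k) ≡ D T (suc i) (suc k)
             → OptimalAlignment i k → OptimalAlignment (suc i) (suc k)
    via-diag min≡ a = record
      { offset = offset ; len = suc len ; fits = fits′ ; path = diag path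
      ; D≡cost = extend-cost min≡ D≡cost fits′ }
      where
      open OptimalAlignment a
      fits′ : offset + suc (suc len) ≡ suc (suc _)
      fits′ = trans (ℕ.+-suc offset (suc len)) (cong suc fits)

    via-up : ∀ {i k} → neighbourMin (D T) (suc i) k ≡ D T (suc i) (suc k)
           → OptimalAlignment i k → OptimalAlignment (suc i) k
    via-up min≡ a = record
      { offset = offset ; len = len ; fits = fits ; path = down path
      ; D≡cost = extend-cost min≡ D≡cost fits }
      where open OptimalAlignment a

    via-left : ∀ {i k} → neighbourMin (D T) i (suc k) ≡ D T (suc i) (suc k)
             → OptimalAlignment i k → OptimalAlignment i (suc k)
    via-left min≡ a = record
      { offset = offset ; len = suc len ; fits = fits′ ; path = right path
      ; D≡cost = extend-cost min≡ D≡cost fits′ }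
      where
      open OptimalAlignment a
      fits′ : offset + suc (suc len) ≡ suc (suc _)
      fits′ = trans (ℕ.+-suc offset (suc len)) (cong suc fits)

    optimal-alignment : ∀ i k → OptimalAlignment i k
    optimal-alignment zero    k    = first-row k
    optimal-alignment (suc i) zero =
      via-up (trans (⊓-identityʳ ∞-maximum _) (⊓-identityˡ ∞-maximum _)) (optimal-alignment i zero)
    optimal-alignment (suc i) (suc k)
      with neighbourMin-sel (D T) (suc i) (suc k)
    ... | inj₁ min≡diag        = via-diag min≡diag (optimal-alignment i k)
    ... | inj₂ (inj₁ min≡up)   = via-up min≡up (optimal-alignment i (suc k))
    ... | inj₂ (inj₂ min≡left) = via-left min≡left (optimal-alignment (suc i) k)

    D-≤-DTW : ∀ s n {i j w} → s + n ≡ j → IsDTW δ P (suc i) (shift δ T s) n w → D T (suc i) j ≤∞ w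
    D-≤-DTW s zero    _   refl                        = ≤∞-top
    D-≤-DTW s (suc l) fit (c , refl , (p , refl) , _) = D-≤-shift-cost T s fit p

    D-isD : ∀ i j → IsD δ P T i j (D T i j)
    D-isD zero    j       = refl
    D-isD (suc i) zero    = refl
    D-isD (suc i) (suc j) =
      (offset , offset≤ , subst (λ n → IsDTW δ P (suc i) (shift δ T offset) n (D T (suc i) (suc j)))
                                (sym rest≡) realised)
      , λ s w s≤ → D-≤-DTW s (suc j ∸ s) (ℕ.m+[n∸m]≡n s≤)
      where
      open OptimalAlignment (optimal-alignment i j)
      offset≤ : offset ≤ suc j
      offset≤ = subst (offset ≤_) fits (ℕ.m≤m+n offset (suc len))
      rest≡ : suc j ∸ offset ≡ suc len
      rest≡ = trans (cong (_∸ offset) (sym fits)) (ℕ.m+n∸m≡n offset (suc len))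
      realised : IsDTW δ P (suc i) (shift δ T offset) (suc len) (D T (suc i) (suc j))
      realised = _ , D≡cost , (path , refl) , λ p →
        fin≤fin⁻¹ (subst (_≤∞ fin (cost δ P (shift δ T offset) p)) D≡cost
                         (D-≤-shift-cost T offset fits p))

    D-constant-on-homogeneous-block : ∀ {M N ip′ jp it′ jt}
      → IsRun P M (suc ip′) jp → IsRun T N (suc it′) jt → P (suc ip′) ≡ T (suc it′)
      → ∀ i j → suc ip′ ≤ i → i ≤ jp → suc it′ ≤ j → j ≤ jt → D T i j ≡ D T (suc ip′) (suc it′)
    D-constant-on-homogeneous-block {ip′ = ip′} {jp} {it′} {jt} P-run T-run same-letter =
      HomogeneousBlock.constant (D-recurrence T) (cell-nonneg T) ip′ jp it′ jt
        cols-alike rows-alike corner-free (λ _ _ _ → ≤∞-refl) col₀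
      where
      cols-alike : ∀ r j → suc it′ ≤ j → j ≤ jt → cell T r j ≡ cell T r (suc it′)
      cols-alike r j it≤j j≤jt = cong (d (P r)) (IsRun.const T-run j it≤j j≤jt)
      rows-alike : ∀ i s → suc ip′ ≤ i → i ≤ jp → cell T i s ≡ cell T (suc ip′) s
      rows-alike i s ip≤i i≤jp = cong (λ a → d a (T s)) (IsRun.const P-run i ip≤i i≤jp)
      corner-free : cell T (suc ip′) (suc it′) ≡ 0ℚ
      corner-free = trans (cong (d (P (suc ip′))) (sym same-letter)) (d-refl _)
      col₀ : ∀ i → suc ip′ ≤ i → i ≤ jp → ∞ ≤∞ D T i 0
      col₀ (suc i) _ _ = ≤∞-refl

corollary1 : {A : Set} (δ : Distance A) (M N : ℕ) (P T : Str A)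
    → (ip jp it jt : ℕ)
    → IsRun P M ip jp → IsRun T N it jt → P ip ≡ T it
    → Σ Ext λ q → ∀ i j → ip ≤ i → i ≤ jp → it ≤ j → j ≤ jt → IsD δ P T i j q
corollary1 δ M N P T ip jp it jt P-run T-run same-letter with IsRun.1≤a P-run | IsRun.1≤a T-run
... | s≤s _ | s≤s _ = D T ip it , λ i j ip≤i i≤jp it≤j j≤jt →
  subst (IsD δ P T i j)
        (D-constant-on-homogeneous-block T P-run T-run same-letter i j ip≤i i≤jp it≤j j≤jt)
        (D-isD T i j)
  where open Table δ P
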